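{- Let $\mathbf{k}$ be a field and $q\in\mathbf{k}$ with $q\ne0$. For any integers $1\le k\le n$, in $\mathcal{H}_n$ we have $$\mathcal{B}_n\,\mathcal{B}^*_{n,k}\,\mathcal{B}_{n,k}=q^k\,\mathcal{B}^*_{n-1,k}\,\mathcal{B}_{n,k+1}+[k]_q\big([n+1-k]_q+q^{n+1-k}J_n\big)\mathcal{B}^*_{n-1,k-1}\,\mathcal{B}_{n,k}.$$
   Context: The Hecke algebra $\mathcal{H}_n$ (over a field $\mathbf{k}$, parameter $q$) is generated by $T_1,\dots,T_{n-1}$ subject to $T_i^2=(q-1)T_i+q$, $T_iT_j=T_jT_i$ for $|i-j|>1$, $T_iT_{i+1}T_i=T_{i+1}T_iT_{i+1}$; it has basis $(T_w)_{w\in S_n}$ with $T_w=T_{i_1}\cdots T_{i_r}$ for a reduced expression $w=s_{i_1}\cdots s_{i_r}$, $s_i=(i,i+1)$. We regard $\mathcal{H}_{m}\subseteq\mathcal{H}_n$ for $m\le n$. $[k]_q=1+q+\cdots+q^{k-1}$. For any integer $m$, $\mathcal{B}_m=\sum_{i=1}^m T_{m-1}T_{m-2}\cdots T_i$ and $\mathcal{B}^*_m=\sum_{i=1}^m T_iT_{i+1}\cdots T_{m-1}$ (both $0$ if $m\le 0$); $\mathcal{B}_{n,k}=\mathcal{B}_{n-k+1}\cdots\mathcal{B}_{n-1}\mathcal{B}_n$ and $\mathcal{B}^*_{n,k}=\mathcal{B}^*_n\cdots\mathcal{B}^*_{n-k+1}$ (empty products $=1$); in particular $\mathcal{B}_{n,k}=0$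 for $k>n$. $J_n=\sum_{i=1}^{n-1}q^{i-n}T_{(i,n)}$, with $(i,n)$ a transposition. -}

module Defs where

open import Level using (Level; _⊔_) renaming (suc to lsuc)
open import Data.Nat using (ℕ; zero; suc; _∸_; _≤_; _<_)
import Data.Nat as ℕ
open import Data.Product using (Σ; proj₁)
open import Relation.Nullary using (¬_)
open import Algebra.Bundles using (CommutativeRing; Ring)
open import Algebra.Morphism.Structures using (module RingMorphisms)

record Field (c ℓ : Level) : Set (lsuc (c ⊔ ℓ)) where
  field
    commutativeRing : CommutativeRing c ℓ
  open CommutativeRing commutativeRing public
  field
    0≉1     : ¬ (0# ≈ 1#)
    inverse : ∀ x → ¬ (x ≈ 0#) → Σ Carrier (λ y → x * y ≈ 1#)

record Algebra {c ℓ : Level} (K : Field c ℓ) (a ℓa : Level)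
       : Set (lsuc (c ⊔ ℓ ⊔ a ⊔ ℓa)) where
  field
    ring : Ring a ℓa
  open Ring ring public
  module K = Field K
  field
    ι       : K.Carrier → Carrier
    ι-hom   : RingMorphisms.IsRingHomomorphism K.rawRing rawRing ι
    central : ∀ x y → ι x * y ≈ y * ι x

module _ {c ℓ : Level} (K : Field c ℓ) where
  open Field K

  pow : Carrier → ℕ → Carrier
  pow x zero    = 1#
  pow x (suc m) = x * pow x m

  -- [m]_q = 1 + q + ⋯ + q^(m-1)
  qint : Carrier → ℕ → Carrier
  qint x zero    = 0#
  qint x (suc m) = qint x m + pow x m

-- The Hecke relations for a family T₁,…,T_{n-1} (indexed by ℕ; only the
-- indices 1,…,n-1 matter) in a K-algebra A with parameter q.

record IsHeckeFamily {c ℓ a ℓa : Level} {K : Field c ℓ} (A : Algebra K a ℓa)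
       (q : Field.Carrier K) (n : ℕ) (T : ℕ → Algebra.Carrier A)
       : Set (a ⊔ ℓa) where
  open Algebra A
  field
    quadratic : ∀ i → 1 ≤ i → i ≤ n ∸ 1 →
                T i * T i ≈ ι (q K.+ K.- K.1#) * T i + ι q
    far-comm  : ∀ i j → 1 ≤ i → j ≤ n ∸ 1 → suc i < j →
                T i * T j ≈ T j * T i
    braid     : ∀ i → 1 ≤ i → suc i ≤ n ∸ 1 →
                T i * T (suc i) * T i ≈ T (suc i) * T i * T (suc i)

module HeckeNotation {c ℓ a ℓa : Level} {K : Field c ℓ} (A : Algebra K a ℓa)
       (q : Field.Carrier K) (q≉0 : ¬ (Field._≈_ K q (Field.0# K)))
       (T : ℕ → Algebra.Carrier A) where
  open Algebra A

  Σ₁ : ℕ → (ℕ → Carrier) → Carrier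
  Σ₁ zero    f = 0#
  Σ₁ (suc m) f = Σ₁ m f + f (suc m)

  down : ℕ → ℕ → Carrier
  down i zero    = 1#
  down i (suc c) = T (i ℕ.+ c) * down i c

  up : ℕ → ℕ → Carrier
  up i zero    = 1#
  up i (suc c) = T i * up (suc i) c

  -- B_m = Σ_{i=1}^m T_{m-1} ⋯ T_i   (= 0 for m = 0)
  B : ℕ → Carrier
  B m = Σ₁ m (λ i → down i (m ∸ i))

  B* : ℕ → Carrier
  B* m = Σ₁ m (λ i → up i (m ∸ i))

  -- B_{n,k} = B_{n-k+1} ⋯ B_{n-1} B_n ; B_{n,k+1} = B_{n-k} B_{n,k}
  Bnk : ℕ → ℕ → Carrier
  Bnk n zero    = 1#
  Bnk n (suc k) = B (n ∸ k) * Bnk n k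

  -- B*_{n,k} = B*_n ⋯ B*_{n-k+1} ; B*_{n,k+1} = B*_{n,k} B*_{n-k}
  B*nk : ℕ → ℕ → Carrier
  B*nk n zero    = 1#
  B*nk n (suc k) = B*nk n k * B* (n ∸ k)

  q⁻¹ : K.Carrier
  q⁻¹ = proj₁ (K.inverse q q≉0)

  -- T_{(i,n)} via the reduced word s_i s_{i+1} ⋯ s_{n-1} ⋯ s_{i+1} s_i
  Ttrans : ℕ → ℕ → Carrier
  Ttrans i n = up i (n ∸ i) * down i (n ∸ 1 ∸ i)

  -- J_n = Σ_{i=1}^{n-1} q^{i-n} T_{(i,n)}
  J : ℕ → Carrier
  J n = Σ₁ (n ∸ 1) (λ i → ι (pow K q⁻¹ (n ∸ i)) * Ttrans i n)

{-# OPTIONS --safe #-}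
module Submission where

-- Put X_n = [n]_q + q^n J_n (= J⁺ n n).  The sum defining J_n gives
-- q J_{n+1} = T_n J_n T_n + T_n, and the quadratic relation turns this into
-- X_{n+1} = T_n X_n T_n + T_n + 1, which is exactly the induction step for
-- B_n B*_n = B*_{n-1} T_{n-1} B_{n-1} + X_n.  The braid and quadratic relations make J_n
-- commute with T_1, …, T_{n-2}, and T_{n-1} acts as q on B_{n-1} B_n, hence on every
-- B_{n,k} with k ≥ 2.  The theorem follows by induction on k together with n: for k = 1
-- it is the formula for B_n B*_n multiplied by B_n; in the step
-- B*_{n,k} B_{n,k} = B*_n (B*_{n-1,k-1} B_{n-1,k-1}) B_n, so that formula and the
-- induction hypothesis leave T_{n-1} next to words on which it acts as q, and what
-- remains is the q-integer identity [l]_q [r]_q q + [l+r+1]_q = [l+1]_q [r+1]_q.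

open import Defs
open import Level using (Level)
open import Data.Nat using (ℕ; zero; suc; _∸_; _≤_; _<_; z≤n; s≤s)
import Data.Nat as ℕ
import Data.Nat.Properties as ℕₚ
open import Data.Product using (proj₂)
open import Data.Sum using (inj₁; inj₂)
open import Relation.Nullary using (¬_)
open import Relation.Binary.PropositionalEquality as ≡ using (_≡_)
open import Algebra.Bundles using (Ring)
open import Algebra.Morphism.Structures using (module RingMorphisms)
open import Tactic.MonoidSolver using (solve)
import Algebra.Solver.CommutativeMonoid as CommutativeMonoidSolver

module QIntegers {c ℓ : Level} (K : Field c ℓ) (q : Field.Carrier K) where
  open Field K
  open import Relation.Binary.Reasoning.Setoid setoid

  pow-+ : ∀ a b → pow K q (a ℕ.+ b) ≈ pow K q a * pow K q b
  pow-+ zero    b = sym (*-identityˡ _)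
  pow-+ (suc a) b = trans (*-congˡ (pow-+ a b)) (sym (*-assoc _ _ _))

  qint-+ : ∀ a b → qint K q (a ℕ.+ b) ≈ qint K q a + pow K q a * qint K q b
  qint-+ a zero = begin
    qint K q (a ℕ.+ 0)         ≡⟨ ≡.cong (qint K q) (ℕₚ.+-identityʳ a) ⟩
    qint K q a                 ≈⟨ +-identityʳ _ ⟨
    qint K q a + 0#            ≈⟨ +-congˡ (zeroʳ _) ⟨
    qint K q a + pow K q a * 0# ∎
  qint-+ a (suc b) = begin
    qint K q (a ℕ.+ suc b)                                         ≡⟨ ≡.cong (qint K q) (ℕₚ.+-suc a b) ⟩
    qint K q (a ℕ.+ b) + pow K q (a ℕ.+ b)                         ≈⟨ +-cong (qint-+ a b) (pow-+ a b) ⟩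
    qint K q a + pow K q a * qint K q b + pow K q a * pow K q b   ≈⟨ +-assoc _ _ _ ⟩
    qint K q a + (pow K q a * qint K q b + pow K q a * pow K q b) ≈⟨ +-congˡ (distribˡ _ _ _) ⟨
    qint K q a + pow K q a * qint K q (suc b)                     ∎

  qint-suc-*q : ∀ j → qint K q j * q + 1# ≈ qint K q (suc j)
  qint-suc-*q zero    = +-congʳ (zeroˡ q)
  qint-suc-*q (suc j) = begin
    (qint K q j + pow K q j) * q + 1#     ≈⟨ +-congʳ (distribʳ _ _ _) ⟩
    qint K q j * q + pow K q j * q + 1#   ≈⟨ +-assoc _ _ _ ⟩
    qint K q j * q + (pow K q j * q + 1#) ≈⟨ +-congˡ (+-comm _ _) ⟩
    qint K q j * q + (1# + pow K q j * q) ≈⟨ +-assoc _ _ _ ⟨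
    qint K q j * q + 1# + pow K q j * q   ≈⟨ +-cong (qint-suc-*q j) (*-comm _ _) ⟩
    qint K q (suc j) + pow K q (suc j)    ∎

  qint-*-q-1 : ∀ j → qint K q j * (q + - 1#) + 1# ≈ pow K q j
  qint-*-q-1 zero    = trans (+-congʳ (zeroˡ _)) (+-identityˡ 1#)
  qint-*-q-1 (suc j) = begin
    (L + p) * q-1 + 1#        ≈⟨ +-congʳ (distribʳ _ _ _) ⟩
    L * q-1 + p * q-1 + 1#    ≈⟨ +-assoc _ _ _ ⟩
    L * q-1 + (p * q-1 + 1#)  ≈⟨ +-congˡ (+-comm _ _) ⟩
    L * q-1 + (1# + p * q-1)  ≈⟨ +-assoc _ _ _ ⟨
    L * q-1 + 1# + p * q-1    ≈⟨ +-congʳ (qint-*-q-1 j) ⟩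
    p + p * q-1               ≈⟨ +-congʳ (*-identityʳ p) ⟨
    p * 1# + p * q-1          ≈⟨ distribˡ _ _ _ ⟨
    p * (1# + q-1)            ≈⟨ *-congˡ 1+[q-1]≈q ⟩
    p * q                     ≈⟨ *-comm _ _ ⟩
    q * p                     ∎
    where
    L p q-1 : Carrier
    L = qint K q j
    p = pow K q j
    q-1 = q + - 1#
    1+[q-1]≈q : 1# + (q + - 1#) ≈ q
    1+[q-1]≈q = trans (+-comm _ _) (trans (+-assoc _ _ _) (trans (+-congˡ (-‿inverseˡ 1#)) (+-identityʳ q)))

  qint-suc-*-qint-suc : ∀ l r → qint K q l * (qint K q r * q) + qint K q (suc (l ℕ.+ r))
                        ≈ qint K q (suc l) * qint K q (suc r)
  qint-suc-*-qint-suc l r = begin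
    L * (R * q) + qint K q (suc (l ℕ.+ r))  ≡⟨ ≡.cong (λ i → L * (R * q) + qint K q i) (ℕₚ.+-suc l r) ⟨
    L * (R * q) + qint K q (l ℕ.+ suc r)    ≈⟨ +-congˡ (qint-+ l (suc r)) ⟩
    L * (R * q) + (L + pow K q l * R′)      ≈⟨ +-assoc _ _ _ ⟨
    L * (R * q) + L + pow K q l * R′        ≈⟨ +-congʳ (+-congˡ (*-identityʳ L)) ⟨
    L * (R * q) + L * 1# + pow K q l * R′   ≈⟨ +-congʳ (distribˡ _ _ _) ⟨
    L * (R * q + 1#) + pow K q l * R′       ≈⟨ +-congʳ (*-congˡ (qint-suc-*q r)) ⟩
    L * R′ + pow K q l * R′                 ≈⟨ distribʳ _ _ _ ⟨
    qint K q (suc l) * R′                   ∎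
    where
    L R R′ : Carrier
    L = qint K q l
    R = qint K q r
    R′ = qint K q (suc r)

  qint-suc-*-pow : ∀ l r → qint K q l * pow K q r + pow K q (l ℕ.+ r) ≈ qint K q (suc l) * pow K q r
  qint-suc-*-pow l r = trans (+-congˡ (pow-+ l r)) (sym (distribʳ _ _ _))

module Commutation {a ℓ : Level} (R : Ring a ℓ) where
  open Ring R
  open import Relation.Binary.Reasoning.Setoid setoid

  Commute : Carrier → Carrier → Set ℓ
  Commute x y = x * y ≈ y * x

  commute-0# : ∀ x → Commute x 0#
  commute-0# x = trans (zeroʳ x) (sym (zeroˡ x))

  commute-1# : ∀ x → Commute x 1#
  commute-1# x = trans (*-identityʳ x) (sym (*-identityˡ x))

  commute-* : ∀ {x y z} → Commute x y → Commute x z → Commute x (y * z)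
  commute-* {x} {y} {z} xy xz = begin
    x * (y * z) ≈⟨ *-assoc x y z ⟨
    x * y * z   ≈⟨ *-congʳ xy ⟩
    y * x * z   ≈⟨ *-assoc y x z ⟩
    y * (x * z) ≈⟨ *-congˡ xz ⟩
    y * (z * x) ≈⟨ *-assoc y z x ⟨
    y * z * x   ∎

  commute-+ : ∀ {x y z} → Commute x y → Commute x z → Commute x (y + z)
  commute-+ {x} {y} {z} xy xz = trans (distribˡ x y z) (trans (+-cong xy xz) (sym (distribʳ x y z)))

  commute-resp : ∀ {x y z} → y ≈ z → Commute x y → Commute x z
  commute-resp y≈z xy = trans (*-congˡ (sym y≈z)) (trans xy (*-congʳ y≈z))

  commute-sym : ∀ {x y} → Commute x y → Commute y x
  commute-sym = sym

  commute-float : ∀ {x y} z → Commute x y → x * (y * z) ≈ y * (x * z)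
  commute-float z xy = trans (sym (*-assoc _ _ _)) (trans (*-congʳ xy) (*-assoc _ _ _))

  module _ {s t : Carrier} (braid : s * t * s ≈ t * s * t) where

    braid-conjugate : ∀ {u d} → Commute t u → Commute t d →
                      u * s * t * (s * d) ≈ t * (u * s * d) * t
    braid-conjugate {u} {d} tu td = begin
      u * s * t * (s * d)   ≈⟨ solve *-monoid ⟩
      u * (s * t * s) * d   ≈⟨ *-congʳ (*-congˡ braid) ⟩
      u * (t * s * t) * d   ≈⟨ solve *-monoid ⟩
      u * t * s * (t * d)   ≈⟨ *-cong (*-congʳ (sym tu)) td ⟩
      t * u * s * (d * t)   ≈⟨ solve *-monoid ⟩
      t * (u * s * d) * t   ∎

    commute-braid-conjugate : ∀ {x} → Commute t x → Commute s (t * s * x * s * t)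
    commute-braid-conjugate {x} tx = begin
      s * (t * s * x * s * t)     ≈⟨ solve *-monoid ⟩
      (s * t * s) * (x * (s * t)) ≈⟨ *-congʳ braid ⟩
      (t * s * t) * (x * (s * t)) ≈⟨ solve *-monoid ⟩
      t * s * (t * x) * (s * t)   ≈⟨ *-congʳ (*-congˡ tx) ⟩
      t * s * (x * t) * (s * t)   ≈⟨ solve *-monoid ⟩
      t * s * x * (t * s * t)     ≈⟨ *-congˡ braid ⟨
      t * s * x * (s * t * s)     ≈⟨ solve *-monoid ⟩
      t * s * x * s * t * s       ∎

module Expansion {a ℓ : Level} (R : Ring a ℓ) where
  open Ring R
  open import Relation.Binary.Reasoning.Setoid setoid

  expand-[xy+1][zx+1] : ∀ x y z → (x * y + 1#) * (z * x + 1#) ≈ x * (y * z) * x + (x * y + z * x + 1#)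
  expand-[xy+1][zx+1] x y z = begin
    (x * y + 1#) * (z * x + 1#)                          ≈⟨ distribʳ _ _ _ ⟩
    x * y * (z * x + 1#) + 1# * (z * x + 1#)             ≈⟨ +-cong (distribˡ _ _ _) (*-identityˡ _) ⟩
    x * y * (z * x) + x * y * 1# + (z * x + 1#)          ≈⟨ +-congʳ (+-cong xy[zx]≈x[yz]x (*-identityʳ _)) ⟩
    x * (y * z) * x + x * y + (z * x + 1#)               ≈⟨ +-assoc _ _ _ ⟩
    x * (y * z) * x + (x * y + (z * x + 1#))             ≈⟨ +-congˡ (+-assoc _ _ _) ⟨
    x * (y * z) * x + (x * y + z * x + 1#)               ∎
    where
    xy[zx]≈x[yz]x : x * y * (z * x) ≈ x * (y * z) * x
    xy[zx]≈x[yz]x = solve *-monoid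

  expand-[x+1]y[z+1] : ∀ x y z → (x + 1#) * y * (z + 1#) ≈ x * y * z + x * y + y * z + y
  expand-[x+1]y[z+1] x y z = begin
    (x + 1#) * y * (z + 1#)               ≈⟨ *-congʳ (trans (distribʳ _ _ _) (+-congˡ (*-identityˡ y))) ⟩
    (x * y + y) * (z + 1#)                ≈⟨ distribʳ _ _ _ ⟩
    x * y * (z + 1#) + y * (z + 1#)       ≈⟨ +-cong (trans (distribˡ _ _ _) (+-congˡ (*-identityʳ _)))
                                                    (trans (distribˡ _ _ _) (+-congˡ (*-identityʳ _))) ⟩
    (x * y * z + x * y) + (y * z + y)     ≈⟨ +-assoc _ _ _ ⟨
    x * y * z + x * y + y * z + y         ∎

module CentralScalars {ℓ₁ ℓ₂ ℓ₃ ℓ₄ : Level} {K : Field ℓ₁ ℓ₂} (A : Algebra K ℓ₃ ℓ₄) where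
  open Algebra A
  open Commutation ring
  open RingMorphisms.IsRingHomomorphism ι-hom public
    using () renaming (⟦⟧-cong to ι-cong; +-homo to ι-+; *-homo to ι-*; 1#-homo to ι-1#)
  open import Relation.Binary.Reasoning.Setoid setoid
  private module CM = CommutativeMonoidSolver +-commutativeMonoid

  ι-commute : ∀ k x → Commute x (ι k)
  ι-commute k x = sym (central k x)

  ι-float : ∀ k x y → x * (ι k * y) ≈ ι k * (x * y)
  ι-float k x y = begin
    x * (ι k * y) ≈⟨ *-assoc _ _ _ ⟨
    x * ι k * y   ≈⟨ *-congʳ (central k x) ⟨
    ι k * x * y   ≈⟨ *-assoc _ _ _ ⟩
    ι k * (x * y) ∎

  ι-float-middle : ∀ k x y z → x * (ι k * y) * z ≈ ι k * (x * y * z)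
  ι-float-middle k x y z = trans (*-congʳ (ι-float k x y)) (*-assoc _ _ _)

  ι-*-assoc : ∀ k l x → ι k * (ι l * x) ≈ ι (k K.* l) * x
  ι-*-assoc k l x = trans (sym (*-assoc _ _ _)) (*-congʳ (sym (ι-* k l)))

  ι-+-distrib : ∀ k l x → ι k * x + ι l * x ≈ ι (k K.+ l) * x
  ι-+-distrib k l x = trans (sym (distribʳ _ _ _)) (*-congʳ (sym (ι-+ k l)))

  ι-1#-identity : ∀ x → ι K.1# * x ≈ x
  ι-1#-identity x = trans (*-congʳ ι-1#) (*-identityˡ x)

  commute-eigen : ∀ {t x y} k → Commute t x → t * y ≈ ι k * y → t * (x * y) ≈ ι k * (x * y)
  commute-eigen {t} {x} {y} k tx ty = begin
    t * (x * y)   ≈⟨ *-assoc _ _ _ ⟨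
    t * x * y     ≈⟨ *-congʳ tx ⟩
    x * t * y     ≈⟨ *-assoc _ _ _ ⟩
    x * (t * y)   ≈⟨ *-congˡ ty ⟩
    x * (ι k * y) ≈⟨ ι-float _ _ _ ⟩
    ι k * (x * y) ∎

  module _ (u v : Carrier) where

    ι-*-lincomb : ∀ k a b → ι k * (ι a * u + ι b * v) ≈ ι (k K.* a) * u + ι (k K.* b) * v
    ι-*-lincomb k a b = trans (distribˡ _ _ _) (+-cong (ι-*-assoc _ _ _) (ι-*-assoc _ _ _))

    ι-+-lincomb : ∀ a b a′ b′ → (ι a * u + ι b * v) + (ι a′ * u + ι b′ * v)
                                 ≈ ι (a K.+ a′) * u + ι (b K.+ b′) * v
    ι-+-lincomb a b a′ b′ = begin
      (ι a * u + ι b * v) + (ι a′ * u + ι b′ * v) ≈⟨ +-assoc _ _ _ ⟩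
      ι a * u + (ι b * v + (ι a′ * u + ι b′ * v)) ≈⟨ +-congˡ (+-assoc _ _ _) ⟨
      ι a * u + ((ι b * v + ι a′ * u) + ι b′ * v) ≈⟨ +-congˡ (+-congʳ (+-comm _ _)) ⟩
      ι a * u + ((ι a′ * u + ι b * v) + ι b′ * v) ≈⟨ +-congˡ (+-assoc _ _ _) ⟩
      ι a * u + (ι a′ * u + (ι b * v + ι b′ * v)) ≈⟨ +-assoc _ _ _ ⟨
      (ι a * u + ι a′ * u) + (ι b * v + ι b′ * v) ≈⟨ +-cong (ι-+-distrib _ _ _) (ι-+-distrib _ _ _) ⟩
      ι (a K.+ a′) * u + ι (b K.+ b′) * v         ∎

    ι-lincomb-cong : ∀ {a a′ b b′} → a K.≈ a′ → b K.≈ b′ →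
                     ι a * u + ι b * v ≈ ι a′ * u + ι b′ * v
    ι-lincomb-cong a≈a′ b≈b′ = +-cong (*-congʳ (ι-cong a≈a′)) (*-congʳ (ι-cong b≈b′))

  module _ (q : K.Carrier) where
    open QIntegers K q

    ι[q-1]*x+x≈ι[q]*x : ∀ x → ι (q K.+ K.- K.1#) * x + x ≈ ι q * x
    ι[q-1]*x+x≈ι[q]*x x = begin
      ι (q K.+ K.- K.1#) * x + x           ≈⟨ +-congˡ (ι-1#-identity x) ⟨
      ι (q K.+ K.- K.1#) * x + ι K.1# * x  ≈⟨ ι-+-distrib _ _ x ⟩
      ι (q K.+ K.- K.1# K.+ K.1#) * x      ≈⟨ *-congʳ (ι-cong q-1+1≈q) ⟩
      ι q * x                              ∎
      where
      q-1+1≈q : q K.+ K.- K.1# K.+ K.1# K.≈ q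
      q-1+1≈q = K.trans (K.+-assoc _ _ _) (K.trans (K.+-congˡ (K.-‿inverseˡ K.1#)) (K.+-identityʳ q))

    ι-qint-suc-*q : ∀ j → ι (qint K q j) * ι q + 1# ≈ ι (qint K q (suc j))
    ι-qint-suc-*q j =
      trans (+-cong (sym (ι-* _ _)) (sym ι-1#)) (trans (sym (ι-+ _ _)) (ι-cong (qint-suc-*q j)))

    ι-qint-*-q-1 : ∀ j x → ι (qint K q j) * (ι (q K.+ K.- K.1#) * x) + x ≈ ι (pow K q j) * x
    ι-qint-*-q-1 j x = begin
      ι (qint K q j) * (ι (q K.+ K.- K.1#) * x) + x         ≈⟨ +-cong (ι-*-assoc _ _ _) (sym (ι-1#-identity x)) ⟩
      ι (qint K q j K.* (q K.+ K.- K.1#)) * x + ι K.1# * x  ≈⟨ ι-+-distrib _ _ _ ⟩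
      ι (qint K q j K.* (q K.+ K.- K.1#) K.+ K.1#) * x      ≈⟨ *-congʳ (ι-cong (qint-*-q-1 j)) ⟩
      ι (pow K q j) * x                                     ∎

    ι-qint-lincomb : ∀ l r u v →
      ι (qint K q l) * (ι (qint K q r K.* q) * u + ι (pow K q r) * v)
        + (ι (qint K q (suc (l ℕ.+ r))) * u + ι (pow K q (l ℕ.+ r)) * v)
      ≈ ι (qint K q (suc l)) * (ι (qint K q (suc r)) * u + ι (pow K q r) * v)
    ι-qint-lincomb l r u v = begin
      ι L * (ι (R K.* q) * u + ι Qʳ * v) + (ι [l+r+1] * u + ι Qˡ⁺ʳ * v)
        ≈⟨ +-congʳ (ι-*-lincomb u v _ _ _) ⟩
      ι (L K.* (R K.* q)) * u + ι (L K.* Qʳ) * v + (ι [l+r+1] * u + ι Qˡ⁺ʳ * v)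
        ≈⟨ ι-+-lincomb u v _ _ _ _ ⟩
      ι (L K.* (R K.* q) K.+ [l+r+1]) * u + ι (L K.* Qʳ K.+ Qˡ⁺ʳ) * v
        ≈⟨ ι-lincomb-cong u v (qint-suc-*-qint-suc l r) (qint-suc-*-pow l r) ⟩
      ι (qint K q (suc l) K.* qint K q (suc r)) * u + ι (qint K q (suc l) K.* Qʳ) * v
        ≈⟨ ι-*-lincomb u v _ _ _ ⟨
      ι (qint K q (suc l)) * (ι (qint K q (suc r)) * u + ι Qʳ * v) ∎
      where
      L R Qʳ [l+r+1] Qˡ⁺ʳ : K.Carrier
      L = qint K q l
      R = qint K q r
      Qʳ = pow K q r
      [l+r+1] = qint K q (suc (l ℕ.+ r))
      Qˡ⁺ʳ = pow K q (l ℕ.+ r)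

    module _ {t : Carrier} (quadratic : t * t ≈ ι (q K.+ K.- K.1#) * t + ι q) where

      commute-braid-quadratic : ∀ {s} → s * t * s ≈ t * s * t → Commute s (t * s * t + ι q * t)
      commute-braid-quadratic {s} braid = trans expandˡ (trans (+-congˡ (+-comm _ _)) (sym expandʳ))
        where
        q-1 : K.Carrier
        q-1 = q K.+ K.- K.1#
        s[tst]≈tst·t : s * (t * s * t) ≈ t * s * (t * t)
        s[tst]≈tst·t = begin
          s * (t * s * t) ≈⟨ solve *-monoid ⟩
          s * t * s * t   ≈⟨ *-congʳ braid ⟩
          t * s * t * t   ≈⟨ *-assoc _ _ _ ⟩
          t * s * (t * t) ∎
        tst·s≈tt·st : t * s * t * s ≈ t * t * (s * t)
        tst·s≈tt·st = begin
          t * s * t * s   ≈⟨ solve *-monoid ⟩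
          t * (s * t * s) ≈⟨ *-congˡ braid ⟩
          t * (t * s * t) ≈⟨ solve *-monoid ⟩
          t * t * (s * t) ∎
        expandˡ : s * (t * s * t + ι q * t) ≈ ι q-1 * (t * s * t) + (ι q * (t * s) + ι q * (s * t))
        expandˡ = begin
          s * (t * s * t + ι q * t)                           ≈⟨ distribˡ _ _ _ ⟩
          s * (t * s * t) + s * (ι q * t)                     ≈⟨ +-cong s[tst]≈tst·t (ι-float _ _ _) ⟩
          t * s * (t * t) + ι q * (s * t)                     ≈⟨ +-congʳ (*-congˡ quadratic) ⟩
          t * s * (ι q-1 * t + ι q) + ι q * (s * t)           ≈⟨ +-congʳ (distribˡ _ _ _) ⟩
          t * s * (ι q-1 * t) + t * s * ι q + ι q * (s * t)   ≈⟨ +-congʳ (+-cong (ι-float _ _ _) (ι-commute _ _)) ⟩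
          ι q-1 * (t * s * t) + ι q * (t * s) + ι q * (s * t) ≈⟨ +-assoc _ _ _ ⟩
          ι q-1 * (t * s * t) + (ι q * (t * s) + ι q * (s * t)) ∎
        expandʳ : (t * s * t + ι q * t) * s ≈ ι q-1 * (t * s * t) + (ι q * (s * t) + ι q * (t * s))
        expandʳ = begin
          (t * s * t + ι q * t) * s                           ≈⟨ distribʳ _ _ _ ⟩
          t * s * t * s + ι q * t * s                         ≈⟨ +-cong tst·s≈tt·st (*-assoc _ _ _) ⟩
          t * t * (s * t) + ι q * (t * s)                     ≈⟨ +-congʳ (*-congʳ quadratic) ⟩
          (ι q-1 * t + ι q) * (s * t) + ι q * (t * s)         ≈⟨ +-congʳ (distribʳ _ _ _) ⟩
          ι q-1 * t * (s * t) + ι q * (s * t) + ι q * (t * s) ≈⟨ +-congʳ (+-congʳ (*-assoc _ _ _)) ⟩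
          ι q-1 * (t * (s * t)) + ι q * (s * t) + ι q * (t * s) ≈⟨ +-congʳ (+-congʳ (*-congˡ (*-assoc _ _ _))) ⟨
          ι q-1 * (t * s * t) + ι q * (s * t) + ι q * (t * s) ≈⟨ +-assoc _ _ _ ⟩
          ι q-1 * (t * s * t) + (ι q * (s * t) + ι q * (t * s)) ∎

      quadratic-eigen : t * (t + 1#) ≈ ι q * (t + 1#)
      quadratic-eigen = begin
        t * (t + 1#)                    ≈⟨ distribˡ _ _ _ ⟩
        t * t + t * 1#                  ≈⟨ +-cong quadratic (*-identityʳ t) ⟩
        ι q-1 * t + ι q + t             ≈⟨ +-assoc _ _ _ ⟩
        ι q-1 * t + (ι q + t)           ≈⟨ +-congˡ (+-comm _ _) ⟩
        ι q-1 * t + (t + ι q)           ≈⟨ +-assoc _ _ _ ⟨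
        ι q-1 * t + t + ι q             ≈⟨ +-cong (ι[q-1]*x+x≈ι[q]*x t) (sym (*-identityʳ _)) ⟩
        ι q * t + ι q * 1#              ≈⟨ distribˡ _ _ _ ⟨
        ι q * (t + 1#)                  ∎
        where
        q-1 : K.Carrier
        q-1 = q K.+ K.- K.1#

      conjugate-qint-pow : ∀ n y → t * (ι (qint K q n) + ι (pow K q n) * y) * t + (t + 1#)
                                   ≈ ι (qint K q (suc n)) + ι (pow K q n) * (t * y * t + t)
      conjugate-qint-pow n y = begin
        t * (ι [n] + ι qⁿ * y) * t + (t + 1#)
          ≈⟨ +-congʳ (trans (*-congʳ (distribˡ _ _ _)) (distribʳ _ _ _)) ⟩
        t * ι [n] * t + t * (ι qⁿ * y) * t + (t + 1#)
          ≈⟨ +-congʳ (+-cong (trans (*-congʳ (ι-commute _ _)) (*-assoc _ _ _))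
                              (ι-float-middle _ _ _ _)) ⟩
        ι [n] * (t * t) + ι qⁿ * (t * y * t) + (t + 1#)
          ≈⟨ +-congʳ (+-congʳ (trans (*-congˡ quadratic) (distribˡ _ _ _))) ⟩
        ι [n] * (ι q-1 * t) + ι [n] * ι q + ι qⁿ * (t * y * t) + (t + 1#)
          ≈⟨ CM.solve 5 (λ a b c d e → ((a ⊕ b) ⊕ c) ⊕ (d ⊕ e) ⊜ (b ⊕ e) ⊕ (c ⊕ (a ⊕ d)))
                        refl _ _ _ _ _ ⟩
        (ι [n] * ι q + 1#) + (ι qⁿ * (t * y * t) + (ι [n] * (ι q-1 * t) + t))
          ≈⟨ +-cong (ι-qint-suc-*q n) (+-congˡ (ι-qint-*-q-1 n t)) ⟩
        ι (qint K q (suc n)) + (ι qⁿ * (t * y * t) + ι qⁿ * t)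
          ≈⟨ +-congˡ (distribˡ _ _ _) ⟨
        ι (qint K q (suc n)) + ι qⁿ * (t * y * t + t) ∎
        where
        open CM using (_⊕_; _⊜_)
        q-1 [n] qⁿ : K.Carrier
        q-1 = q K.+ K.- K.1#
        [n] = qint K q n
        qⁿ = pow K q n

module HeckeWords {ℓ₁ ℓ₂ ℓ₃ ℓ₄ : Level} {K : Field ℓ₁ ℓ₂} (A : Algebra K ℓ₃ ℓ₄)
       (q : Field.Carrier K) (q≉0 : ¬ (Field._≈_ K q (Field.0# K)))
       (T : ℕ → Algebra.Carrier A) where
  open Algebra A
  open HeckeNotation A q q≉0 T
  open Commutation ring
  open CentralScalars A
  open import Relation.Binary.Reasoning.Setoid setoid

  private
    i+[m∸i]≤b : ∀ {i m b} → i ≤ m → m ≤ b → i ℕ.+ (m ∸ i) ≤ b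
    i+[m∸i]≤b i≤m m≤b = ℕₚ.≤-trans (ℕₚ.≤-reflexive (ℕₚ.m+[n∸m]≡n i≤m)) m≤b

  Σ₁-cong : ∀ m {f g : ℕ → Carrier} → (∀ i → 1 ≤ i → i ≤ m → f i ≈ g i) → Σ₁ m f ≈ Σ₁ m g
  Σ₁-cong zero    f≈g = refl
  Σ₁-cong (suc m) f≈g = +-cong (Σ₁-cong m (λ i 1≤i i≤m → f≈g i 1≤i (ℕₚ.m≤n⇒m≤1+n i≤m)))
                                (f≈g (suc m) (s≤s z≤n) ℕₚ.≤-refl)

  Σ₁-*ˡ : ∀ m x (f : ℕ → Carrier) → Σ₁ m (λ i → x * f i) ≈ x * Σ₁ m f
  Σ₁-*ˡ zero    x f = sym (zeroʳ x)
  Σ₁-*ˡ (suc m) x f = trans (+-congʳ (Σ₁-*ˡ m x f)) (sym (distribˡ x _ _))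

  Σ₁-*ʳ : ∀ m x (f : ℕ → Carrier) → Σ₁ m (λ i → f i * x) ≈ Σ₁ m f * x
  Σ₁-*ʳ zero    x f = sym (zeroˡ x)
  Σ₁-*ʳ (suc m) x f = trans (+-congʳ (Σ₁-*ʳ m x f)) (sym (distribʳ x _ _))

  commute-Σ₁ : ∀ {x} m {f : ℕ → Carrier} →
               (∀ i → 1 ≤ i → i ≤ m → Commute x (f i)) → Commute x (Σ₁ m f)
  commute-Σ₁ {x} zero    xf = commute-0# x
  commute-Σ₁     (suc m) xf = commute-+ (commute-Σ₁ m (λ i 1≤i i≤m → xf i 1≤i (ℕₚ.m≤n⇒m≤1+n i≤m)))
                                         (xf (suc m) (s≤s z≤n) ℕₚ.≤-refl)

  ι-q⁻¹-cancel : ∀ x → ι q⁻¹ * (ι q * x) ≈ x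
  ι-q⁻¹-cancel x = begin
    ι q⁻¹ * (ι q * x)  ≈⟨ ι-*-assoc _ _ _ ⟩
    ι (q⁻¹ K.* q) * x  ≈⟨ *-congʳ (ι-cong (K.trans (K.*-comm _ _) (proj₂ (K.inverse q q≉0)))) ⟩
    ι K.1# * x         ≈⟨ ι-1#-identity x ⟩
    x                  ∎

  ι-pow-q⁻¹ : ∀ j x → ι (pow K q (suc j)) * (ι q⁻¹ * x) ≈ ι (pow K q j) * x
  ι-pow-q⁻¹ j x = begin
    ι (q K.* pow K q j) * (ι q⁻¹ * x)     ≈⟨ *-congʳ (ι-cong (K.*-comm _ _)) ⟩
    ι (pow K q j K.* q) * (ι q⁻¹ * x)     ≈⟨ ι-*-assoc _ _ _ ⟨
    ι (pow K q j) * (ι q * (ι q⁻¹ * x))   ≈⟨ *-congˡ (ι-float _ _ _) ⟨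
    ι (pow K q j) * (ι q⁻¹ * (ι q * x))   ≈⟨ *-congˡ (ι-q⁻¹-cancel x) ⟩
    ι (pow K q j) * x                     ∎

  up-suc : ∀ i c → up i (suc c) ≈ up i c * T (i ℕ.+ c)
  up-suc i zero = begin
    T i * 1#      ≈⟨ commute-1# (T i) ⟩
    1# * T i      ≡⟨ ≡.cong (λ j → 1# * T j) (ℕₚ.+-identityʳ i) ⟨
    1# * T (i ℕ.+ 0) ∎
  up-suc i (suc c) = begin
    T i * up (suc i) (suc c)                ≈⟨ *-congˡ (up-suc (suc i) c) ⟩
    T i * (up (suc i) c * T (suc i ℕ.+ c))  ≈⟨ *-assoc _ _ _ ⟨
    T i * up (suc i) c * T (suc i ℕ.+ c)    ≡⟨ ≡.cong (λ j → up i (suc c) * T j) (ℕₚ.+-suc i c) ⟨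
    T i * up (suc i) c * T (i ℕ.+ suc c)    ∎

  B-suc : ∀ m → B (suc m) ≈ T m * B m + 1#
  B-suc m = +-cong (trans (Σ₁-cong m down-suc) (Σ₁-*ˡ m (T m) _))
                   (reflexive (≡.cong (down (suc m)) (ℕₚ.n∸n≡0 m)))
    where
    down-suc : ∀ i → 1 ≤ i → i ≤ m → down i (suc m ∸ i) ≈ T m * down i (m ∸ i)
    down-suc i _ i≤m rewrite ℕₚ.+-∸-assoc 1 i≤m | ℕₚ.m+[n∸m]≡n i≤m = refl

  B*-suc : ∀ m → B* (suc m) ≈ B* m * T m + 1#
  B*-suc m = +-cong (trans (Σ₁-cong m up-suc′) (Σ₁-*ʳ m (T m) _))
                    (reflexive (≡.cong (up (suc m)) (ℕₚ.n∸n≡0 m)))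
    where
    up-suc′ : ∀ i → 1 ≤ i → i ≤ m → up i (suc m ∸ i) ≈ up i (m ∸ i) * T m
    up-suc′ i _ i≤m rewrite ℕₚ.+-∸-assoc 1 i≤m =
      trans (up-suc i (m ∸ i)) (reflexive (≡.cong (λ j → up i (m ∸ i) * T j) (ℕₚ.m+[n∸m]≡n i≤m)))

  B*nk-suc : ∀ n k → B*nk n (suc k) ≈ B* n * B*nk (n ∸ 1) k
  B*nk-suc n zero    = sym (commute-1# (B* n))
  B*nk-suc n (suc k) = begin
    B*nk n (suc k) * B* (n ∸ suc k)          ≈⟨ *-congʳ (B*nk-suc n k) ⟩
    B* n * B*nk (n ∸ 1) k * B* (n ∸ suc k)   ≈⟨ *-assoc _ _ _ ⟩
    B* n * (B*nk (n ∸ 1) k * B* (n ∸ suc k)) ≡⟨ ≡.cong (λ j → B* n * (B*nk (n ∸ 1) k * B* j))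
                                                         (ℕₚ.∸-+-assoc n 1 k) ⟨
    B* n * B*nk (n ∸ 1) (suc k)              ∎

  Bnk-suc : ∀ n k → Bnk n (suc k) ≈ Bnk (n ∸ 1) k * B n
  Bnk-suc n zero    = commute-1# (B n)
  Bnk-suc n (suc k) = begin
    B (n ∸ suc k) * Bnk n (suc k)          ≈⟨ *-congˡ (Bnk-suc n k) ⟩
    B (n ∸ suc k) * (Bnk (n ∸ 1) k * B n)  ≈⟨ *-assoc _ _ _ ⟨
    B (n ∸ suc k) * Bnk (n ∸ 1) k * B n    ≡⟨ ≡.cong (λ j → B j * Bnk (n ∸ 1) k * B n)
                                                       (ℕₚ.∸-+-assoc n 1 k) ⟨
    Bnk (n ∸ 1) (suc k) * B n              ∎

  CommutesWithGenerators : Carrier → ℕ → Set ℓ₄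
  CommutesWithGenerators x b = ∀ i → 1 ≤ i → i < b → Commute x (T i)

  module _ {x : Carrier} {b : ℕ} (x-gens : CommutesWithGenerators x b) where

    up-commute : ∀ i c → 1 ≤ i → i ℕ.+ c ≤ b → Commute x (up i c)
    up-commute i zero    _   _     = commute-1# x
    up-commute i (suc c) 1≤i i+c≤b = commute-* (x-gens i 1≤i (ℕₚ.m+n≤o⇒m≤o (suc i) i+c<b))
                                               (up-commute (suc i) c (s≤s z≤n) i+c<b)
      where
      i+c<b : suc i ℕ.+ c ≤ b
      i+c<b = ≡.subst (_≤ b) (ℕₚ.+-suc i c) i+c≤b

    down-commute : ∀ i c → 1 ≤ i → i ℕ.+ c ≤ b → Commute x (down i c)
    down-commute i zero    _   _     = commute-1# x
    down-commute i (suc c) 1≤i i+c≤b =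
      commute-* (x-gens (i ℕ.+ c) (ℕₚ.≤-trans 1≤i (ℕₚ.m≤m+n i c)) i+c<b)
                (down-commute i c 1≤i (ℕₚ.<⇒≤ i+c<b))
      where
      i+c<b : i ℕ.+ c < b
      i+c<b = ≡.subst (_≤ b) (ℕₚ.+-suc i c) i+c≤b

    B-commute : ∀ m → m ≤ b → Commute x (B m)
    B-commute m m≤b = commute-Σ₁ m (λ i 1≤i i≤m → down-commute i (m ∸ i) 1≤i (i+[m∸i]≤b i≤m m≤b))

    B*-commute : ∀ m → m ≤ b → Commute x (B* m)
    B*-commute m m≤b = commute-Σ₁ m (λ i 1≤i i≤m → up-commute i (m ∸ i) 1≤i (i+[m∸i]≤b i≤m m≤b))

    B*nk-commute : ∀ m k → m ≤ b → Commute x (B*nk m k)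
    B*nk-commute m zero    _   = commute-1# x
    B*nk-commute m (suc k) m≤b = commute-* (B*nk-commute m k m≤b)
                                           (B*-commute (m ∸ k) (ℕₚ.≤-trans (ℕₚ.m∸n≤m m k) m≤b))

    J-commute : ∀ m → m ≤ b → Commute x (J m)
    J-commute m m≤b =
      commute-Σ₁ (m ∸ 1) (λ i 1≤i i≤m-1 → commute-* (ι-commute _ x) (Ttrans-commute i 1≤i i≤m-1))
      where
      m-1≤b : m ∸ 1 ≤ b
      m-1≤b = ℕₚ.≤-trans (ℕₚ.m∸n≤m m 1) m≤b
      Ttrans-commute : ∀ i → 1 ≤ i → i ≤ m ∸ 1 → Commute x (Ttrans i m)
      Ttrans-commute i 1≤i i≤m-1 =
        commute-* (up-commute i (m ∸ i) 1≤i (i+[m∸i]≤b (ℕₚ.≤-trans i≤m-1 (ℕₚ.m∸n≤m m 1)) m≤b))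
                  (down-commute i (m ∸ 1 ∸ i) 1≤i (i+[m∸i]≤b i≤m-1 m-1≤b))

  J⁺ : ℕ → ℕ → Carrier
  J⁺ r n = ι (qint K q r) + ι (pow K q r) * J n

module HeckeRelations {ℓ₁ ℓ₂ ℓ₃ ℓ₄ : Level} {K : Field ℓ₁ ℓ₂} (A : Algebra K ℓ₃ ℓ₄)
       (q : Field.Carrier K) (q≉0 : ¬ (Field._≈_ K q (Field.0# K)))
       (N : ℕ) (T : ℕ → Algebra.Carrier A) (hecke : IsHeckeFamily A q N T) where
  open Algebra A
  open HeckeNotation A q q≉0 T
  open HeckeWords A q q≉0 T
  open Commutation ring
  open Expansion ring
  open CentralScalars A
  open IsHeckeFamily hecke
  open import Relation.Binary.Reasoning.Setoid setoid
  private module CM = CommutativeMonoidSolver +-commutativeMonoid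

  private
    <N⇒≤N-1 : ∀ {i} → i < N → i ≤ N ∸ 1
    <N⇒≤N-1 = ℕₚ.∸-monoˡ-≤ 1

  T-quadratic : ∀ i → 1 ≤ i → i < N → T i * T i ≈ ι (q K.+ K.- K.1#) * T i + ι q
  T-quadratic i 1≤i i<N = quadratic i 1≤i (<N⇒≤N-1 i<N)

  T-braid : ∀ i → 1 ≤ i → suc i < N → T i * T (suc i) * T i ≈ T (suc i) * T i * T (suc i)
  T-braid i 1≤i i+1<N = braid i 1≤i (<N⇒≤N-1 i+1<N)

  T-commutesWithGenerators : ∀ m → m < N → CommutesWithGenerators (T m) (m ∸ 1)
  T-commutesWithGenerators zero    _     _ _   ()
  T-commutesWithGenerators (suc m) m+1<N i 1≤i i<m = sym (far-comm i (suc m) 1≤i (<N⇒≤N-1 m+1<N) (s≤s i<m))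

  Ttrans-suc : ∀ i m → 1 ≤ i → i ≤ m → suc m < N →
               Ttrans i (suc (suc m)) ≈ T (suc m) * Ttrans i (suc m) * T (suc m)
  Ttrans-suc i m 1≤i i≤m m+1<N = begin
    up i (suc (suc m) ∸ i) * down i (suc m ∸ i)
      ≡⟨ ≡.cong₂ (λ a b → up i a * down i b) (ℕₚ.+-∸-assoc 2 i≤m) (ℕₚ.+-∸-assoc 1 i≤m) ⟩
    up i (suc (suc d)) * down i (suc d)
      ≈⟨ *-congʳ (trans (up-suc i (suc d)) (*-congʳ (up-suc i d))) ⟩
    up i d * T (i ℕ.+ d) * T (i ℕ.+ suc d) * (T (i ℕ.+ d) * down i d)
      ≡⟨ ≡.cong₂ (λ a b → up i d * T a * T b * (T a * down i d)) i+d≡m i+d+1≡m+1 ⟩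
    up i d * T m * T (suc m) * (T m * down i d)
      ≈⟨ braid-conjugate (T-braid m (ℕₚ.≤-trans 1≤i i≤m) m+1<N)
                         (up-commute t-gens i d 1≤i i+d≤m) (down-commute t-gens i d 1≤i i+d≤m) ⟩
    T (suc m) * (up i d * T m * down i d) * T (suc m)
      ≈⟨ *-congʳ (*-congˡ (*-congʳ (trans (up-suc i d) (reflexive (≡.cong (λ a → up i d * T a) i+d≡m))))) ⟨
    T (suc m) * (up i (suc d) * down i d) * T (suc m)
      ≡⟨ ≡.cong (λ a → T (suc m) * (up i a * down i d) * T (suc m)) (ℕₚ.+-∸-assoc 1 i≤m) ⟨
    T (suc m) * Ttrans i (suc m) * T (suc m) ∎
    where
    d : ℕ
    d = m ∸ i
    i+d≡m : i ℕ.+ d ≡ m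
    i+d≡m = ℕₚ.m+[n∸m]≡n i≤m
    i+d+1≡m+1 : i ℕ.+ suc d ≡ suc m
    i+d+1≡m+1 = ≡.trans (ℕₚ.+-suc i d) (≡.cong suc i+d≡m)
    i+d≤m : i ℕ.+ d ≤ m
    i+d≤m = ℕₚ.≤-reflexive i+d≡m
    t-gens : CommutesWithGenerators (T (suc m)) m
    t-gens = T-commutesWithGenerators (suc m) m+1<N

  J-suc : ∀ m → suc m < N → J (suc (suc m)) ≈ ι q⁻¹ * (T (suc m) * J (suc m) * T (suc m) + T (suc m))
  J-suc m m+1<N = begin
    Σ₁ m (λ i → ι (pow K q⁻¹ (suc (suc m) ∸ i)) * Ttrans i (suc (suc m)))
      + ι (pow K q⁻¹ (suc m ∸ m)) * Ttrans (suc m) (suc (suc m))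
      ≈⟨ +-cong (Σ₁-cong m conjugate-summand) last-summand ⟩
    Σ₁ m (λ i → ι q⁻¹ * (t * g i * t)) + ι q⁻¹ * t
      ≈⟨ +-congʳ (trans (Σ₁-*ˡ m _ _) (*-congˡ (trans (Σ₁-*ʳ m t _) (*-congʳ (Σ₁-*ˡ m t g))))) ⟩
    ι q⁻¹ * (t * J (suc m) * t) + ι q⁻¹ * t
      ≈⟨ distribˡ _ _ _ ⟨
    ι q⁻¹ * (t * J (suc m) * t + t) ∎
    where
    t : Carrier
    t = T (suc m)
    g : ℕ → Carrier
    g i = ι (pow K q⁻¹ (suc m ∸ i)) * Ttrans i (suc m)
    conjugate-summand : ∀ i → 1 ≤ i → i ≤ m →
      ι (pow K q⁻¹ (suc (suc m) ∸ i)) * Ttrans i (suc (suc m)) ≈ ι q⁻¹ * (t * g i * t)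
    conjugate-summand i 1≤i i≤m = begin
      ι (pow K q⁻¹ (suc (suc m) ∸ i)) * Ttrans i (suc (suc m))
        ≡⟨ ≡.cong (λ a → ι (pow K q⁻¹ a) * Ttrans i (suc (suc m)))
                  (ℕₚ.+-∸-assoc 1 (ℕₚ.m≤n⇒m≤1+n i≤m)) ⟩
      ι (q⁻¹ K.* pow K q⁻¹ (suc m ∸ i)) * Ttrans i (suc (suc m))
        ≈⟨ *-cong (ι-* _ _) (Ttrans-suc i m 1≤i i≤m m+1<N) ⟩
      ι q⁻¹ * ι (pow K q⁻¹ (suc m ∸ i)) * (t * Ttrans i (suc m) * t)
        ≈⟨ *-assoc _ _ _ ⟩
      ι q⁻¹ * (ι (pow K q⁻¹ (suc m ∸ i)) * (t * Ttrans i (suc m) * t))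
        ≈⟨ *-congˡ (ι-float-middle _ _ _ _) ⟨
      ι q⁻¹ * (t * g i * t) ∎
    last-summand : ι (pow K q⁻¹ (suc m ∸ m)) * Ttrans (suc m) (suc (suc m)) ≈ ι q⁻¹ * t
    last-summand = begin
      ι (pow K q⁻¹ (suc m ∸ m)) * (up (suc m) (suc m ∸ m) * down (suc m) (m ∸ m))
        ≡⟨ ≡.cong₂ (λ a b → ι (pow K q⁻¹ a) * (up (suc m) a * down (suc m) b))
                   (ℕₚ.m+n∸n≡m 1 m) (ℕₚ.n∸n≡0 m) ⟩
      ι (q⁻¹ K.* K.1#) * (t * 1# * 1#)
        ≈⟨ *-cong (ι-cong (K.*-identityʳ q⁻¹)) (trans (*-identityʳ _) (*-identityʳ _)) ⟩
      ι q⁻¹ * t ∎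

  J-suc-commute-far : ∀ m → suc (suc (suc m)) ≤ N → CommutesWithGenerators (J (suc (suc m))) (suc m) →
                      ∀ i → 1 ≤ i → i < suc m → Commute (J (suc (suc (suc m)))) (T i)
  J-suc-commute-far m m+3≤N J-gens i 1≤i i<m+1 =
    commute-sym (commute-resp (sym (J-suc (suc m) m+3≤N))
      (commute-* (ι-commute _ _) (commute-+ (commute-* (commute-* Ti-b Ti-J) Ti-b) Ti-b)))
    where
    Ti-b : Commute (T i) (T (suc (suc m)))
    Ti-b = far-comm i (suc (suc m)) 1≤i (<N⇒≤N-1 m+3≤N) (s≤s i<m+1)
    Ti-J : Commute (T i) (J (suc (suc m)))
    Ti-J = commute-sym (J-gens i 1≤i i<m+1)

  J-suc-commute-braid : ∀ m → suc (suc (suc m)) ≤ N → Commute (J (suc (suc (suc m)))) (T (suc m))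
  J-suc-commute-braid m m+3≤N =
    commute-sym (commute-resp (sym J-expanded)
      (commute-* (ι-commute _ _) (commute-* (ι-commute _ _)
        (commute-+ (commute-braid-conjugate braid-ab b-J) (commute-braid-quadratic q quadratic-b braid-ab)))))
    where
    a b : Carrier
    a = T (suc m)
    b = T (suc (suc m))
    braid-ab : a * b * a ≈ b * a * b
    braid-ab = T-braid (suc m) (s≤s z≤n) m+3≤N
    quadratic-b : b * b ≈ ι (q K.+ K.- K.1#) * b + ι q
    quadratic-b = T-quadratic (suc (suc m)) (s≤s z≤n) m+3≤N
    b-J : Commute b (J (suc m))
    b-J = J-commute (T-commutesWithGenerators (suc (suc m)) m+3≤N) (suc m) ℕₚ.≤-refl
    b[aca]b≈bacab : ∀ x → b * (a * x * a) * b ≈ b * a * x * a * b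
    b[aca]b≈bacab x = solve *-monoid
    J-expanded : J (suc (suc (suc m)))
                 ≈ ι q⁻¹ * (ι q⁻¹ * (b * a * J (suc m) * a * b + (b * a * b + ι q * b)))
    J-expanded = begin
      J (suc (suc (suc m)))
        ≈⟨ J-suc (suc m) m+3≤N ⟩
      ι q⁻¹ * (b * J (suc (suc m)) * b + b)
        ≈⟨ *-congˡ (+-cong (*-congʳ (*-congˡ (J-suc m (ℕₚ.<⇒≤ m+3≤N)))) (sym (ι-q⁻¹-cancel b))) ⟩
      ι q⁻¹ * (b * (ι q⁻¹ * (a * J (suc m) * a + a)) * b + ι q⁻¹ * (ι q * b))
        ≈⟨ *-congˡ (+-congʳ (ι-float-middle _ _ _ _)) ⟩
      ι q⁻¹ * (ι q⁻¹ * (b * (a * J (suc m) * a + a) * b) + ι q⁻¹ * (ι q * b))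
        ≈⟨ *-congˡ (distribˡ _ _ _) ⟨
      ι q⁻¹ * (ι q⁻¹ * (b * (a * J (suc m) * a + a) * b + ι q * b))
        ≈⟨ *-congˡ (*-congˡ (+-congʳ (trans (*-congʳ (distribˡ _ _ _)) (distribʳ _ _ _)))) ⟩
      ι q⁻¹ * (ι q⁻¹ * (b * (a * J (suc m) * a) * b + b * a * b + ι q * b))
        ≈⟨ *-congˡ (*-congˡ (trans (+-congʳ (+-congʳ (b[aca]b≈bacab _))) (+-assoc _ _ _))) ⟩
      ι q⁻¹ * (ι q⁻¹ * (b * a * J (suc m) * a * b + (b * a * b + ι q * b))) ∎

  J-suc-commutesWithGenerators : ∀ m → suc (suc (suc m)) ≤ N →
                                 CommutesWithGenerators (J (suc (suc m))) (suc m) →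
                                 CommutesWithGenerators (J (suc (suc (suc m)))) (suc (suc m))
  J-suc-commutesWithGenerators m m+3≤N J-gens i 1≤i i<m+2 with ℕₚ.m≤n⇒m<n∨m≡n (ℕₚ.≤-pred i<m+2)
  ... | inj₁ i<m+1  = J-suc-commute-far m m+3≤N J-gens i 1≤i i<m+1
  ... | inj₂ ≡.refl = J-suc-commute-braid m m+3≤N

  J-commutesWithGenerators : ∀ m → suc m ≤ N → CommutesWithGenerators (J (suc m)) m
  J-commutesWithGenerators zero          _     _ _         ()
  J-commutesWithGenerators (suc zero)    _     _ (s≤s z≤n) (s≤s ())
  J-commutesWithGenerators (suc (suc m)) m+3≤N =
    J-suc-commutesWithGenerators m m+3≤N (J-commutesWithGenerators (suc m) (ℕₚ.<⇒≤ m+3≤N))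

  J⁺-commutesWithGenerators : ∀ r m → suc m ≤ N → CommutesWithGenerators (J⁺ r (suc m)) m
  J⁺-commutesWithGenerators r m m+1≤N i 1≤i i<m =
    commute-sym (commute-+ (ι-commute _ _)
                           (commute-* (ι-commute _ _) (commute-sym (J-commutesWithGenerators m m+1≤N i 1≤i i<m))))

  J⁺-diag-suc : ∀ m → suc m < N →
                J⁺ (suc (suc m)) (suc (suc m)) ≈ T (suc m) * J⁺ (suc m) (suc m) * T (suc m) + (T (suc m) + 1#)
  J⁺-diag-suc m m+1<N = begin
    ι (qint K q (suc (suc m))) + ι (pow K q (suc (suc m))) * J (suc (suc m))
      ≈⟨ +-congˡ (*-congˡ (J-suc m m+1<N)) ⟩
    ι (qint K q (suc (suc m))) + ι (pow K q (suc (suc m))) * (ι q⁻¹ * (t * J (suc m) * t + t))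
      ≈⟨ +-congˡ (ι-pow-q⁻¹ (suc m) _) ⟩
    ι (qint K q (suc (suc m))) + ι (pow K q (suc m)) * (t * J (suc m) * t + t)
      ≈⟨ conjugate-qint-pow q (T-quadratic (suc m) (s≤s z≤n) m+1<N) (suc m) (J (suc m)) ⟨
    t * J⁺ (suc m) (suc m) * t + (t + 1#) ∎
    where
    t : Carrier
    t = T (suc m)

  B-B-suc : ∀ j → suc j < N →
            B (suc j) * B (suc (suc j)) ≈ T j * T (suc j) * (B j * B (suc j)) + (T (suc j) + 1#) * B (suc j)
  B-B-suc j j+1<N = begin
    B′ * B (suc (suc j))                 ≈⟨ *-congˡ (B-suc (suc j)) ⟩
    B′ * (t′ * B′ + 1#)                  ≈⟨ trans (distribˡ _ _ _) (+-congˡ (*-identityʳ _)) ⟩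
    B′ * (t′ * B′) + B′                  ≈⟨ +-congʳ (*-congʳ (B-suc j)) ⟩
    (t * B j + 1#) * (t′ * B′) + B′      ≈⟨ +-congʳ (trans (distribʳ _ _ _) (+-congˡ (*-identityˡ _))) ⟩
    t * B j * (t′ * B′) + t′ * B′ + B′   ≈⟨ +-congʳ (+-congʳ tBt′B≈tt′BB) ⟩
    t * t′ * (B j * B′) + t′ * B′ + B′   ≈⟨ +-assoc _ _ _ ⟩
    t * t′ * (B j * B′) + (t′ * B′ + B′) ≈⟨ +-congˡ (trans (distribʳ _ _ _) (+-congˡ (*-identityˡ _))) ⟨
    t * t′ * (B j * B′) + (t′ + 1#) * B′ ∎
    where
    t t′ B′ : Carrier
    t = T j
    t′ = T (suc j)
    B′ = B (suc j)
    tBt′B≈tt′BB : t * B j * (t′ * B′) ≈ t * t′ * (B j * B′)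
    tBt′B≈tt′BB = begin
      t * B j * (t′ * B′)   ≈⟨ solve *-monoid ⟩
      t * (B j * t′) * B′   ≈⟨ *-congʳ (*-congˡ (B-commute t′-gens j ℕₚ.≤-refl)) ⟨
      t * (t′ * B j) * B′   ≈⟨ solve *-monoid ⟩
      t * t′ * (B j * B′)   ∎
      where
      t′-gens : CommutesWithGenerators t′ j
      t′-gens = T-commutesWithGenerators (suc j) j+1<N

  T-B-B-suc : ∀ j → suc (suc j) < N →
              T (suc j) * (B (suc j) * B (suc (suc j))) ≈ ι q * (B (suc j) * B (suc (suc j))) →
              T (suc (suc j)) * (B (suc (suc j)) * B (suc (suc (suc j))))
                ≈ ι q * (B (suc (suc j)) * B (suc (suc (suc j))))
  T-B-B-suc j j+2<N t-Q = begin
    t′ * (B′ * B (suc (suc (suc j))))            ≈⟨ *-congˡ (B-B-suc (suc j) j+2<N) ⟩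
    t′ * (t * t′ * Q + (t′ + 1#) * B′)          ≈⟨ distribˡ _ _ _ ⟩
    t′ * (t * t′ * Q) + t′ * ((t′ + 1#) * B′)  ≈⟨ +-cong braid-absorb eigen-absorb ⟩
    ι q * (t * t′ * Q) + ι q * ((t′ + 1#) * B′) ≈⟨ distribˡ _ _ _ ⟨
    ι q * (t * t′ * Q + (t′ + 1#) * B′)         ≈⟨ *-congˡ (B-B-suc (suc j) j+2<N) ⟨
    ι q * (B′ * B (suc (suc (suc j))))           ∎
    where
    t t′ B′ Q : Carrier
    t = T (suc j)
    t′ = T (suc (suc j))
    B′ = B (suc (suc j))
    Q = B (suc j) * B′
    braid-absorb : t′ * (t * t′ * Q) ≈ ι q * (t * t′ * Q)
    braid-absorb = begin
      t′ * (t * t′ * Q)   ≈⟨ *-assoc _ _ _ ⟨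
      t′ * (t * t′) * Q   ≈⟨ *-congʳ (*-assoc _ _ _) ⟨
      t′ * t * t′ * Q     ≈⟨ *-congʳ (T-braid (suc j) (s≤s z≤n) j+2<N) ⟨
      t * t′ * t * Q      ≈⟨ *-assoc _ _ _ ⟩
      t * t′ * (t * Q)    ≈⟨ *-congˡ t-Q ⟩
      t * t′ * (ι q * Q)  ≈⟨ ι-float _ _ _ ⟩
      ι q * (t * t′ * Q)  ∎
    eigen-absorb : t′ * ((t′ + 1#) * B′) ≈ ι q * ((t′ + 1#) * B′)
    eigen-absorb = begin
      t′ * ((t′ + 1#) * B′)  ≈⟨ *-assoc _ _ _ ⟨
      t′ * (t′ + 1#) * B′    ≈⟨ *-congʳ (quadratic-eigen q (T-quadratic (suc (suc j)) (s≤s z≤n) j+2<N)) ⟩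
      ι q * (t′ + 1#) * B′   ≈⟨ *-assoc _ _ _ ⟩
      ι q * ((t′ + 1#) * B′) ∎

  T-B-B : ∀ j → j < N → T j * (B j * B (suc j)) ≈ ι q * (B j * B (suc j))
  T-B-B zero          _   = trans (*-congˡ (zeroˡ _)) (trans (zeroʳ _) (sym (trans (*-congˡ (zeroˡ _)) (zeroʳ _))))
  T-B-B (suc zero)    1<N = begin
    T 1 * (B 1 * B 2)    ≈⟨ *-congˡ B₁B₂≈T₁+1 ⟩
    T 1 * (T 1 + 1#)     ≈⟨ quadratic-eigen q (T-quadratic 1 (s≤s z≤n) 1<N) ⟩
    ι q * (T 1 + 1#)     ≈⟨ *-congˡ B₁B₂≈T₁+1 ⟨
    ι q * (B 1 * B 2)    ∎
    where
    B₁B₂≈T₁+1 : B 1 * B 2 ≈ T 1 + 1#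
    B₁B₂≈T₁+1 =
      trans (*-congʳ (+-identityˡ 1#)) (trans (*-identityˡ _) (+-congʳ (trans (+-identityˡ _) (*-identityʳ _))))
  T-B-B (suc (suc j)) j+2<N = T-B-B-suc j j+2<N (T-B-B (suc j) (ℕₚ.<⇒≤ j+2<N))

  T-Bnk : ∀ m k → m < N → T m * Bnk (suc m) (suc (suc k)) ≈ ι q * Bnk (suc m) (suc (suc k))
  T-Bnk m zero    m<N = begin
    T m * (B m * (B (suc m) * 1#)) ≈⟨ *-congˡ (*-congˡ (*-identityʳ _)) ⟩
    T m * (B m * B (suc m))        ≈⟨ T-B-B m m<N ⟩
    ι q * (B m * B (suc m))        ≈⟨ *-congˡ (*-congˡ (*-identityʳ _)) ⟨
    ι q * (B m * (B (suc m) * 1#)) ∎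
  T-Bnk m (suc k) m<N =
    commute-eigen q (B-commute (T-commutesWithGenerators m m<N) (m ∸ suc k) (ℕₚ.∸-monoʳ-≤ m (s≤s z≤n)))
                    (T-Bnk m k m<N)

  conjugate-B*TB : ∀ m → suc m < N →
                   T (suc m) * (B* m * T m * B m) * T (suc m) ≈ B* m * T m * T (suc m) * (T m * B m)
  conjugate-B*TB zero    _ = begin
    T 1 * (0# * T 0 * 0#) * T 1 ≈⟨ *-congʳ (trans (*-congˡ (zeroʳ _)) (zeroʳ _)) ⟩
    0# * T 1                    ≈⟨ zeroˡ _ ⟩
    0#                          ≈⟨ trans (*-congˡ (zeroʳ _)) (zeroʳ _) ⟨
    0# * T 0 * T 1 * (T 0 * 0#) ∎
  conjugate-B*TB (suc m) m+2<N = begin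
    t′ * (b* * t * b) * t′       ≈⟨ solve *-monoid ⟩
    t′ * b* * t * (b * t′)       ≈⟨ *-cong (*-congʳ (B*-commute t′-gens (suc m) ℕₚ.≤-refl))
                                           (sym (B-commute t′-gens (suc m) ℕₚ.≤-refl)) ⟩
    b* * t′ * t * (t′ * b)       ≈⟨ solve *-monoid ⟩
    b* * (t′ * t * t′) * b       ≈⟨ *-congʳ (*-congˡ (T-braid (suc m) (s≤s z≤n) m+2<N)) ⟨
    b* * (t * t′ * t) * b        ≈⟨ solve *-monoid ⟩
    b* * t * t′ * (t * b)        ∎
    where
    t t′ b b* : Carrier
    t = T (suc m)
    t′ = T (suc (suc m))
    b = B (suc m)
    b* = B* (suc m)
    t′-gens : CommutesWithGenerators t′ (suc m)
    t′-gens = T-commutesWithGenerators (suc (suc m)) m+2<N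

  B-B*-suc : ∀ m → suc (suc m) ≤ N →
             B (suc m) * B* (suc m) ≈ B* m * T m * B m + J⁺ (suc m) (suc m) →
             B (suc (suc m)) * B* (suc (suc m))
               ≈ B* (suc m) * T (suc m) * B (suc m) + J⁺ (suc (suc m)) (suc (suc m))
  B-B*-suc m m+2≤N ih = begin
    B (suc (suc m)) * B* (suc (suc m))
      ≈⟨ *-cong (B-suc (suc m)) (B*-suc (suc m)) ⟩
    (t′ * B′ + 1#) * (B*′ * t′ + 1#)
      ≈⟨ expand-[xy+1][zx+1] t′ B′ B*′ ⟩
    t′ * (B′ * B*′) * t′ + (t′ * B′ + B*′ * t′ + 1#)
      ≈⟨ +-congʳ (*-congʳ (*-congˡ ih)) ⟩
    t′ * (b* * t * b + X′) * t′ + (t′ * B′ + B*′ * t′ + 1#)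
      ≈⟨ +-congʳ (trans (*-congʳ (distribˡ _ _ _)) (distribʳ _ _ _)) ⟩
    t′ * (b* * t * b) * t′ + t′ * X′ * t′ + (t′ * B′ + B*′ * t′ + 1#)
      ≈⟨ +-cong (+-congʳ (conjugate-B*TB m m+2≤N)) (+-congʳ (+-cong t′B′≈ B*′t′≈)) ⟩
    P + t′ * X′ * t′ + (U + t′ + (V + t′) + 1#)
      ≈⟨ CM.solve 6 (λ P Q U V t′ 1# → (P ⊕ Q) ⊕ (((U ⊕ t′) ⊕ (V ⊕ t′)) ⊕ 1#)
                                     ⊜ (((P ⊕ V) ⊕ U) ⊕ t′) ⊕ (Q ⊕ (t′ ⊕ 1#))) refl _ _ _ _ _ _ ⟩
    P + V + U + t′ + (t′ * X′ * t′ + (t′ + 1#))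
      ≈⟨ +-cong (expand-[x+1]y[z+1] (b* * t) t′ (t * b)) (J⁺-diag-suc m m+2≤N) ⟨
    (b* * t + 1#) * t′ * (t * b + 1#) + J⁺ (suc (suc m)) (suc (suc m))
      ≈⟨ +-congʳ (*-cong (*-congʳ (B*-suc m)) (B-suc m)) ⟨
    B*′ * t′ * B′ + J⁺ (suc (suc m)) (suc (suc m)) ∎
    where
    open CM using (_⊕_; _⊜_)
    t t′ b b* B′ B*′ X′ P U V : Carrier
    t = T m
    t′ = T (suc m)
    b = B m
    b* = B* m
    B′ = B (suc m)
    B*′ = B* (suc m)
    X′ = J⁺ (suc m) (suc m)
    P = b* * t * t′ * (t * b)
    U = t′ * (t * b)
    V = b* * t * t′
    t′B′≈ : t′ * B′ ≈ U + t′
    t′B′≈ = trans (*-congˡ (B-suc m)) (trans (distribˡ _ _ _) (+-congˡ (*-identityʳ _)))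
    B*′t′≈ : B*′ * t′ ≈ V + t′
    B*′t′≈ = trans (*-congʳ (B*-suc m)) (trans (distribʳ _ _ _) (+-congˡ (*-identityˡ _)))

  B-B* : ∀ m → suc m ≤ N → B (suc m) * B* (suc m) ≈ B* m * T m * B m + J⁺ (suc m) (suc m)
  B-B* zero    _ = begin
    (0# + 1#) * (0# + 1#)                           ≈⟨ trans (*-cong (+-identityˡ 1#) (+-identityˡ 1#)) (*-identityˡ 1#) ⟩
    1#                                              ≈⟨ trans (ι-cong (K.+-identityˡ K.1#)) ι-1# ⟨
    ι (K.0# K.+ K.1#)                               ≈⟨ trans (+-congˡ (zeroʳ _)) (+-identityʳ _) ⟨
    ι (K.0# K.+ K.1#) + ι (q K.* K.1#) * 0#         ≈⟨ +-identityˡ _ ⟨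
    0# + (ι (K.0# K.+ K.1#) + ι (q K.* K.1#) * 0#)  ≈⟨ +-congʳ (zeroʳ _) ⟨
    0# * T 0 * 0# + J⁺ 1 1                          ∎
  B-B* (suc m) m+2≤N = B-B*-suc m m+2≤N (B-B* m (ℕₚ.<⇒≤ m+2≤N))

  module _ (m : ℕ) (m+2≤N : suc (suc m) ≤ N) {y : Carrier} (t-y : T (suc m) * y ≈ ι q * y) where
    private
      t : Carrier
      t = T (suc m)

    J-absorb : J (suc (suc m)) * y ≈ t * J (suc m) * y + y
    J-absorb = begin
      J (suc (suc m)) * y                              ≈⟨ *-congʳ (J-suc m m+2≤N) ⟩
      ι q⁻¹ * (t * J (suc m) * t + t) * y              ≈⟨ *-assoc _ _ _ ⟩
      ι q⁻¹ * ((t * J (suc m) * t + t) * y)            ≈⟨ *-congˡ (trans (distribʳ _ _ _)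
                                                                           (+-congʳ (*-assoc _ _ _))) ⟩
      ι q⁻¹ * (t * J (suc m) * (t * y) + t * y)        ≈⟨ *-congˡ (+-cong (*-congˡ t-y) t-y) ⟩
      ι q⁻¹ * (t * J (suc m) * (ι q * y) + ι q * y)    ≈⟨ *-congˡ (+-congʳ (ι-float _ _ _)) ⟩
      ι q⁻¹ * (ι q * (t * J (suc m) * y) + ι q * y)    ≈⟨ *-congˡ (distribˡ _ _ _) ⟨
      ι q⁻¹ * (ι q * (t * J (suc m) * y + y))          ≈⟨ ι-q⁻¹-cancel _ ⟩
      t * J (suc m) * y + y                            ∎

    J⁺-absorb : ∀ s → J⁺ s (suc (suc m)) * y
                      ≈ ι (qint K q (suc s)) * y + ι (pow K q s) * (t * J (suc m) * y)
    J⁺-absorb s = begin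
      (ι [s] + ι qˢ * J (suc (suc m))) * y               ≈⟨ trans (distribʳ _ _ _) (+-congˡ (*-assoc _ _ _)) ⟩
      ι [s] * y + ι qˢ * (J (suc (suc m)) * y)            ≈⟨ +-congˡ (trans (*-congˡ J-absorb) (distribˡ _ _ _)) ⟩
      ι [s] * y + (ι qˢ * (t * J (suc m) * y) + ι qˢ * y) ≈⟨ +-congˡ (+-comm _ _) ⟩
      ι [s] * y + (ι qˢ * y + ι qˢ * (t * J (suc m) * y)) ≈⟨ +-assoc _ _ _ ⟨
      ι [s] * y + ι qˢ * y + ι qˢ * (t * J (suc m) * y)   ≈⟨ +-congʳ (ι-+-distrib _ _ _) ⟩
      ι (qint K q (suc s)) * y + ι qˢ * (t * J (suc m) * y) ∎
      where
      [s] qˢ : K.Carrier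
      [s] = qint K q s
      qˢ = pow K q s

    T-J⁺-absorb : ∀ s → t * (J⁺ s (suc m) * y)
                        ≈ ι (qint K q s K.* q) * y + ι (pow K q s) * (t * J (suc m) * y)
    T-J⁺-absorb s = begin
      t * ((ι [s] + ι qˢ * J (suc m)) * y)             ≈⟨ *-congˡ (trans (distribʳ _ _ _)
                                                                          (+-congˡ (*-assoc _ _ _))) ⟩
      t * (ι [s] * y + ι qˢ * (J (suc m) * y))         ≈⟨ distribˡ _ _ _ ⟩
      t * (ι [s] * y) + t * (ι qˢ * (J (suc m) * y))   ≈⟨ +-cong (ι-float _ _ _) (ι-float _ _ _) ⟩
      ι [s] * (t * y) + ι qˢ * (t * (J (suc m) * y))   ≈⟨ +-cong (trans (*-congˡ t-y) (ι-*-assoc _ _ _))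
                                                                 (*-congˡ (sym (*-assoc _ _ _))) ⟩
      ι ([s] K.* q) * y + ι qˢ * (t * J (suc m) * y)   ∎
      where
      [s] qˢ : K.Carrier
      [s] = qint K q s
      qˢ = pow K q s

  ProductFormula : ℕ → ℕ → Set ℓ₄
  ProductFormula n k =
    B n * B*nk n k * Bnk n k
      ≈ ι (pow K q k) * B*nk (n ∸ 1) k * Bnk n (suc k)
        + ι (qint K q k) * J⁺ (n ℕ.+ 1 ∸ k) n * B*nk (n ∸ 1) (k ∸ 1) * Bnk n k

  productFormula-one : ∀ m → suc m ≤ N → ProductFormula (suc m) 1
  productFormula-one m m+1≤N = begin
    B n * (1# * B* n) * (B n * 1#)             ≈⟨ *-cong (*-congˡ (*-identityˡ _)) (*-identityʳ _) ⟩
    B n * B* n * B n                           ≈⟨ *-congʳ (B-B* m m+1≤N) ⟩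
    (B* m * T m * B m + J⁺ n n) * B n          ≈⟨ distribʳ _ _ _ ⟩
    B* m * T m * B m * B n + J⁺ n n * B n      ≈⟨ +-congʳ B*TBB≈qB*BB ⟩
    ι q * (B* m * (B m * B n)) + J⁺ n n * B n  ≈⟨ +-cong first second ⟨
    ι (q K.* K.1#) * (1# * B* m) * (B m * (B n * 1#))
      + ι (K.0# K.+ K.1#) * J⁺ (n ℕ.+ 1 ∸ 1) n * 1# * (B n * 1#) ∎
    where
    n : ℕ
    n = suc m
    B*TBB≈qB*BB : B* m * T m * B m * B n ≈ ι q * (B* m * (B m * B n))
    B*TBB≈qB*BB = begin
      B* m * T m * B m * B n     ≈⟨ solve *-monoid ⟩
      B* m * (T m * (B m * B n)) ≈⟨ *-congˡ (T-B-B m m+1≤N) ⟩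
      B* m * (ι q * (B m * B n)) ≈⟨ ι-float _ _ _ ⟩
      ι q * (B* m * (B m * B n)) ∎
    first : ι (q K.* K.1#) * (1# * B* m) * (B m * (B n * 1#)) ≈ ι q * (B* m * (B m * B n))
    first = trans (*-cong (*-cong (ι-cong (K.*-identityʳ q)) (*-identityˡ _)) (*-congˡ (*-identityʳ _)))
                  (*-assoc _ _ _)
    second : ι (K.0# K.+ K.1#) * J⁺ (n ℕ.+ 1 ∸ 1) n * 1# * (B n * 1#) ≈ J⁺ n n * B n
    second = begin
      ι (K.0# K.+ K.1#) * J⁺ (n ℕ.+ 1 ∸ 1) n * 1# * (B n * 1#) ≈⟨ *-cong (*-identityʳ _) (*-identityʳ _) ⟩
      ι (K.0# K.+ K.1#) * J⁺ (n ℕ.+ 1 ∸ 1) n * B n            ≈⟨ *-congʳ (trans (*-congʳ (ι-cong (K.+-identityˡ K.1#)))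
                                                                                (ι-1#-identity _)) ⟩
      J⁺ (n ℕ.+ 1 ∸ 1) n * B n                                 ≡⟨ ≡.cong (λ r → J⁺ r n * B n) (ℕₚ.+-comm m 1) ⟩
      J⁺ n n * B n                                             ∎

  module ProductFormulaStep (m l : ℕ) (m+2≤N : suc (suc m) ≤ N) (l≤m : l ≤ m) where
    private
      m₁ n l₁ k r : ℕ
      m₁ = suc m
      n = suc m₁
      l₁ = suc l
      k = suc l₁
      r = m ℕ.+ 1 ∸ l
      t : Carrier
      t = T m₁
      t-absorb : ∀ j i → t * (B*nk m j * Bnk n (suc (suc i))) ≈ ι q * (B*nk m j * Bnk n (suc (suc i)))
      t-absorb j i = commute-eigen q (B*nk-commute (T-commutesWithGenerators m₁ m+2≤N) m j ℕₚ.≤-refl)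
                                     (T-Bnk m₁ i m+2≤N)
      -- Every term of the step becomes B* m₁ * YG a b; ι-qint-lincomb compares the coefficients.
      Y G : Carrier
      Y = B*nk m l * Bnk n k
      G = t * J m₁ * Y
      YG : K.Carrier → K.Carrier → Carrier
      YG a b = ι a * Y + ι b * G

    first-term : B* m₁ * t * (ι (pow K q l₁) * B*nk m l₁ * Bnk m₁ (suc l₁)) * B n
                 ≈ ι (pow K q k) * B*nk m₁ k * Bnk n (suc k)
    first-term = begin
      B* m₁ * t * (ι qˡ * B*nk m l₁ * Bnk m₁ (suc l₁)) * B n
        ≈⟨ solve *-monoid ⟩
      B* m₁ * (t * (ι qˡ * (B*nk m l₁ * (Bnk m₁ (suc l₁) * B n))))
        ≈⟨ *-congˡ (*-congˡ (*-congˡ (*-congˡ (Bnk-suc n (suc l₁))))) ⟨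
      B* m₁ * (t * (ι qˡ * (B*nk m l₁ * Bnk n (suc k))))
        ≈⟨ *-congˡ (trans (ι-float _ _ _) (*-congˡ (t-absorb l₁ l₁))) ⟩
      B* m₁ * (ι qˡ * (ι q * (B*nk m l₁ * Bnk n (suc k))))
        ≈⟨ trans (*-congˡ (ι-*-assoc _ _ _)) (ι-float _ _ _) ⟩
      ι (qˡ K.* q) * (B* m₁ * (B*nk m l₁ * Bnk n (suc k)))
        ≈⟨ *-cong (ι-cong (K.*-comm _ _)) (trans (sym (*-assoc _ _ _)) (*-congʳ (sym (B*nk-suc m₁ l₁)))) ⟩
      ι (pow K q k) * (B*nk m₁ k * Bnk n (suc k))
        ≈⟨ *-assoc _ _ _ ⟨
      ι (pow K q k) * B*nk m₁ k * Bnk n (suc k) ∎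
      where
      qˡ : K.Carrier
      qˡ = pow K q l₁

    second-term : B* m₁ * t * (ι (qint K q l₁) * J⁺ r m₁ * B*nk m l * Bnk m₁ l₁) * B n
                  ≈ ι (qint K q l₁) * (B* m₁ * YG (qint K q r K.* q) (pow K q r))
    second-term = begin
      B* m₁ * t * (ι [l] * J⁺ r m₁ * B*nk m l * Bnk m₁ l₁) * B n
        ≈⟨ solve *-monoid ⟩
      B* m₁ * (t * (ι [l] * (J⁺ r m₁ * (B*nk m l * (Bnk m₁ l₁ * B n)))))
        ≈⟨ *-congˡ (*-congˡ (*-congˡ (*-congˡ (*-congˡ (Bnk-suc n l₁))))) ⟨
      B* m₁ * (t * (ι [l] * (J⁺ r m₁ * Y)))
        ≈⟨ *-congˡ (trans (ι-float _ _ _) (*-congˡ (T-J⁺-absorb m m+2≤N (t-absorb l l) r))) ⟩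
      B* m₁ * (ι [l] * YG (qint K q r K.* q) (pow K q r))
        ≈⟨ ι-float _ _ _ ⟩
      ι [l] * (B* m₁ * YG (qint K q r K.* q) (pow K q r)) ∎
      where
      [l] : K.Carrier
      [l] = qint K q l₁

    J⁺-B*nk-Bnk : ∀ s → J⁺ s n * (B*nk m₁ l₁ * Bnk n k) ≈ B* m₁ * YG (qint K q (suc s)) (pow K q s)
    J⁺-B*nk-Bnk s = begin
      J⁺ s n * (B*nk m₁ l₁ * Bnk n k)  ≈⟨ *-congˡ (trans (*-congʳ (B*nk-suc m₁ l)) (*-assoc _ _ _)) ⟩
      J⁺ s n * (B* m₁ * Y)             ≈⟨ commute-float Y (B*-commute J⁺-gens m₁ ℕₚ.≤-refl) ⟩
      B* m₁ * (J⁺ s n * Y)             ≈⟨ *-congˡ (J⁺-absorb m m+2≤N (t-absorb l l) s) ⟩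
      B* m₁ * YG (qint K q (suc s)) (pow K q s) ∎
      where
      J⁺-gens : CommutesWithGenerators (J⁺ s n) m₁
      J⁺-gens = J⁺-commutesWithGenerators s m₁ m+2≤N

    combine : ι (qint K q l₁) * (B* m₁ * YG (qint K q r K.* q) (pow K q r))
                + B* m₁ * YG (qint K q (suc n)) (pow K q n)
              ≈ ι (qint K q k) * (B* m₁ * YG (qint K q (suc r)) (pow K q r))
    combine = begin
      ι [l] * (B* m₁ * Z) + B* m₁ * YG (qint K q (suc n)) (pow K q n)
        ≈⟨ trans (+-congʳ (sym (ι-float _ _ _))) (sym (distribˡ _ _ _)) ⟩
      B* m₁ * (ι [l] * Z + YG (qint K q (suc n)) (pow K q n))
        ≡⟨ ≡.cong (λ j → B* m₁ * (ι [l] * Z + YG (qint K q (suc j)) (pow K q j))) n≡l₁+r ⟩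
      B* m₁ * (ι [l] * Z + YG (qint K q (suc (l₁ ℕ.+ r))) (pow K q (l₁ ℕ.+ r)))
        ≈⟨ *-congˡ (ι-qint-lincomb q l₁ r Y G) ⟩
      B* m₁ * (ι (qint K q k) * YG (qint K q (suc r)) (pow K q r))
        ≈⟨ ι-float _ _ _ ⟩
      ι (qint K q k) * (B* m₁ * YG (qint K q (suc r)) (pow K q r)) ∎
      where
      [l] : K.Carrier
      [l] = qint K q l₁
      Z : Carrier
      Z = YG (qint K q r K.* q) (pow K q r)
      n≡l₁+r : n ≡ l₁ ℕ.+ r
      n≡l₁+r = ≡.cong suc (≡.sym (≡.trans (ℕₚ.m+[n∸m]≡n (ℕₚ.≤-trans l≤m (ℕₚ.m≤m+n m 1)))
                                          (ℕₚ.+-comm m 1)))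

    productFormula-suc : ProductFormula m₁ l₁ → ProductFormula n k
    productFormula-suc ih = begin
      B n * B*nk n k * Bnk n k
        ≈⟨ *-cong (*-congˡ (B*nk-suc n l₁)) (Bnk-suc n l₁) ⟩
      B n * (B* n * B*nk m₁ l₁) * (Bnk m₁ l₁ * B n)
        ≈⟨ solve *-monoid ⟩
      B n * B* n * (B*nk m₁ l₁ * Bnk m₁ l₁ * B n)
        ≈⟨ trans (*-congʳ (B-B* m₁ m+2≤N)) (distribʳ _ _ _) ⟩
      B* m₁ * t * B m₁ * (B*nk m₁ l₁ * Bnk m₁ l₁ * B n) + J⁺ n n * (B*nk m₁ l₁ * Bnk m₁ l₁ * B n)
        ≈⟨ +-cong regroup (*-congˡ (trans (*-assoc _ _ _) (*-congˡ (sym (Bnk-suc n l₁))))) ⟩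
      B* m₁ * t * (B m₁ * B*nk m₁ l₁ * Bnk m₁ l₁) * B n + J⁺ n n * (B*nk m₁ l₁ * Bnk n k)
        ≈⟨ +-congʳ (trans (*-congʳ (*-congˡ ih)) (trans (*-congʳ (distribˡ _ _ _)) (distribʳ _ _ _))) ⟩
      B* m₁ * t * (ι (pow K q l₁) * B*nk m l₁ * Bnk m₁ (suc l₁)) * B n
        + B* m₁ * t * (ι (qint K q l₁) * J⁺ r m₁ * B*nk m l * Bnk m₁ l₁) * B n
        + J⁺ n n * (B*nk m₁ l₁ * Bnk n k)
        ≈⟨ trans (+-cong (+-cong first-term second-term) (J⁺-B*nk-Bnk n)) (+-assoc _ _ _) ⟩
      ι (pow K q k) * B*nk m₁ k * Bnk n (suc k)
        + (ι (qint K q l₁) * (B* m₁ * YG (qint K q r K.* q) (pow K q r))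
           + B* m₁ * YG (qint K q (suc n)) (pow K q n))
        ≈⟨ +-congˡ combine ⟩
      ι (pow K q k) * B*nk m₁ k * Bnk n (suc k) + ι (qint K q k) * (B* m₁ * YG (qint K q (suc r)) (pow K q r))
        ≈⟨ +-congˡ (trans (trans (*-assoc _ _ _) (*-assoc _ _ _)) (*-congˡ (J⁺-B*nk-Bnk r))) ⟨
      ι (pow K q k) * B*nk m₁ k * Bnk n (suc k) + ι (qint K q k) * J⁺ r n * B*nk m₁ l₁ * Bnk n k ∎
      where
      regroup : B* m₁ * t * B m₁ * (B*nk m₁ l₁ * Bnk m₁ l₁ * B n)
                ≈ B* m₁ * t * (B m₁ * B*nk m₁ l₁ * Bnk m₁ l₁) * B n
      regroup = solve *-monoid

  productFormula : ∀ n k → n ≤ N → 1 ≤ k → k ≤ n → ProductFormula n k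
  productFormula (suc m)       (suc zero)    m+1≤N _ _                 = productFormula-one m m+1≤N
  productFormula (suc (suc m)) (suc (suc l)) m+2≤N _ (s≤s (s≤s l≤m)) =
    ProductFormulaStep.productFormula-suc m l m+2≤N l≤m
      (productFormula (suc m) (suc l) (ℕₚ.<⇒≤ m+2≤N) (s≤s z≤n) (s≤s l≤m))

lemma3p5 : {c ℓ a ℓa : Level} (K : Field c ℓ) (A : Algebra K a ℓa)
           (q : Field.Carrier K) (q≉0 : ¬ (Field._≈_ K q (Field.0# K)))
           (n : ℕ) (T : ℕ → Algebra.Carrier A) → IsHeckeFamily A q n T →
           (k : ℕ) → 1 ≤ k → k ≤ n →
           let open Algebra A
               open HeckeNotation A q q≉0 T
           in B n * B*nk n k * Bnk n k
              ≈ ι (pow K q k) * B*nk (n ∸ 1) k * Bnk n (suc k)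
                + ι (qint K q k)
                  * (ι (qint K q (n ℕ.+ 1 ∸ k)) + ι (pow K q (n ℕ.+ 1 ∸ k)) * J n)
                  * B*nk (n ∸ 1) (k ∸ 1) * Bnk n k
lemma3p5 K A q q≉0 n T hecke k 1≤k k≤n =
  HeckeRelations.productFormula A q q≉0 n T hecke n k ℕₚ.≤-refl 1≤k k≤n
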